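{- There exist a set $D$ and models $A\subsetneq B$ over $D$ such that $A$ is isomorphic to $B$, i.e., there is a bijection $\pi:D\to D$ with $A\succsim_\pi B$ and $B\succsim_{\pi^{ -1}}A$.
   Context: A model of computation over a set $D$ is any set of functions $f:D\to D\cup\{\bot\}$, where $\bot$ denotes "undefined". An encoding $\rho$ is an injection extended by $\rho(\bot)=\bot$. Model $A$ simulates model $B$ via $\rho$, written $A\succsim_\rho B$, if for every $g\in B$ there is $f\in A$ with $\rho\circ g=f\circ\rho$. -}

module Defs where

open import Data.Maybe using (Maybe; just; nothing; map)
open import Data.Product using (Σ; ∃; _×_; _,_)
open import Relation.Binary.PropositionalEquality using (_≡_)
open import Relation.Nullary using (¬_)
open import Function.Definitions using (Injective)

-- A partial function D → D ∪ {⊥}; ⊥ is represented by nothing.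
PFun : Set → Set
PFun D = D → Maybe D

Model : Set → Set₁
Model D = PFun D → Set

_≗ₚ_ : {D : Set} → PFun D → PFun D → Set
f ≗ₚ g = ∀ x → f x ≡ g x

_∈ₘ_ : {D : Set} → PFun D → Model D → Set
f ∈ₘ A = ∃ λ f' → A f' × (f' ≗ₚ f)

_⊆ₘ_ : {D : Set} → Model D → Model D → Set
A ⊆ₘ B = ∀ f → A f → f ∈ₘ B

_⊊ₘ_ : {D : Set} → Model D → Model D → Set
A ⊊ₘ B = (A ⊆ₘ B) × (∃ λ g → B g × ¬ (g ∈ₘ A))

-- A ≿_ρ B : for every g ∈ B there is f ∈ A with ρ ∘ g = f ∘ ρ,
-- where ρ is extended by ρ(⊥) = ⊥ (i.e. Maybe.map ρ).
-- ρ is required to be an injection (an encoding).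
Simulates : {D : Set} → Model D → (ρ : D → D) → Model D → Set
Simulates {D} A ρ B =
  Injective _≡_ _≡_ ρ ×
  (∀ g → B g → ∃ λ f → A f × (∀ x → map ρ (g x) ≡ f (ρ x)))

{-# OPTIONS --safe #-}
-- Over ℤ, let B be the constant functions with a non-negative value and A
-- those with a positive value. Encoding by the bijection x ↦ x + 1 turns
-- the constant n into the constant n + 1, so it simulates B inside A, and
-- x ↦ x − 1 simulates A inside B; yet the constant 0 lies in B but not in A.
module Submission where

open import Defs
open import Data.Product using (Σ; ∃; _×_; _,_)
open import Relation.Binary.PropositionalEquality using (_≡_; refl; cong; sym; trans; subst)
open import Data.Integer using (ℤ; +_; +[1+_]; 0ℤ; Positive; NonNegative; pred)
  renaming (suc to sucℤ)
open import Data.Integer.Properties using (pred-suc; suc-pred)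
open import Data.Maybe using (just; map)
open import Data.Maybe.Properties using (just-injective)
open import Function using (_∘_)
open import Function.Definitions using (Injective)
open import Function.Consequences.Propositional
  using (inverseʳ⇒injective; strictlyInverseʳ⇒inverseʳ)
open import Relation.Nullary using (¬_)
open import Relation.Unary using (Pred; _∈_; _∉_; _⊆_)
open import Level using (0ℓ)

constant : {D : Set} → D → PFun D
constant d _ = just d

ConstantsIn : {D : Set} → Pred D 0ℓ → Model D
ConstantsIn S g = ∃ λ d → d ∈ S × g ≗ₚ constant d

module _ {D : Set} {S T : Pred D 0ℓ} where

  constantsIn-mono : S ⊆ T → ConstantsIn S ⊆ₘ ConstantsIn T
  constantsIn-mono S⊆T g (d , d∈S , g≗d) = g , (d , S⊆T d∈S , g≗d) , λ _ → refl

  constantsIn-simulates : ∀ {ρ : D → D} → Injective _≡_ _≡_ ρ → S ⊆ T ∘ ρ →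
                          Simulates (ConstantsIn T) ρ (ConstantsIn S)
  constantsIn-simulates {ρ} ρ-inj S⊆T∘ρ = ρ-inj , encode
    where
    encode : ∀ g → ConstantsIn S g →
             ∃ λ f → ConstantsIn T f × (∀ x → map ρ (g x) ≡ f (ρ x))
    encode g (d , d∈S , g≗d) =
      constant (ρ d) , (ρ d , S⊆T∘ρ d∈S , λ _ → refl) , λ x → cong (map ρ) (g≗d x)

  constant∉constantsIn : ∀ {d} → d ∉ S → ¬ (constant d ∈ₘ ConstantsIn S)
  constant∉constantsIn {d} d∉S (f , (d′ , d′∈S , f≗d′) , f≗d) =
    d∉S (subst S (just-injective (trans (sym (f≗d′ d)) (f≗d d))) d′∈S)

  constantsIn-⊊ : ∀ {d} → S ⊆ T → d ∈ T → d ∉ S → ConstantsIn S ⊊ₘ ConstantsIn T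
  constantsIn-⊊ {d} S⊆T d∈T d∉S =
    constantsIn-mono S⊆T , constant d , (d , d∈T , λ _ → refl) , constant∉constantsIn d∉S

nonNegative⇒suc-positive : NonNegative ⊆ Positive ∘ sucℤ
nonNegative⇒suc-positive {+ n} _ = _

positive⇒pred-nonNegative : Positive ⊆ NonNegative ∘ pred
positive⇒pred-nonNegative {+[1+ n ]} _ = _

positive⇒nonNegative : Positive ⊆ NonNegative
positive⇒nonNegative {+ n} _ = _

0∉positive : 0ℤ ∉ Positive
0∉positive ()

sucℤ-injective : Injective _≡_ _≡_ sucℤ
sucℤ-injective = inverseʳ⇒injective sucℤ (strictlyInverseʳ⇒inverseʳ {f⁻¹ = pred} sucℤ pred-suc)

pred-injective : Injective _≡_ _≡_ pred
pred-injective = inverseʳ⇒injective pred (strictlyInverseʳ⇒inverseʳ {f⁻¹ = sucℤ} pred suc-pred)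

mainTheorem7 : Σ Set λ D → Σ (Model D) λ A → Σ (Model D) λ B →
    (A ⊊ₘ B) ×
    (Σ (D → D) λ π → Σ (D → D) λ πinv →
      (∀ x → πinv (π x) ≡ x) × (∀ y → π (πinv y) ≡ y) ×
      Simulates A π B × Simulates B πinv A)
mainTheorem7 =
  ℤ , ConstantsIn Positive , ConstantsIn NonNegative ,
  constantsIn-⊊ positive⇒nonNegative _ 0∉positive ,
  sucℤ , pred , pred-suc , suc-pred ,
  constantsIn-simulates sucℤ-injective nonNegative⇒suc-positive ,
  constantsIn-simulates pred-injective positive⇒pred-nonNegative
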